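{- For all $n \geq 2$, $\mathsf{DL}(Q_n) = n-1$.
   Context: $Q_n$ is the $n$-dimensional hypercube: vertex set $(\mathbb{Z}_2)^n$, two vertices adjacent iff they differ in exactly one coordinate. For a finite connected graph $G=(V,E)$ with $|V|=N$ and graph distance $d$, a $k$-dispersed labelling is a bijection $\phi:\{1,\dots,N\}\to V$ with $d(\phi(i),\phi(i+1))\ge k$ for $1\le i\le N-1$; $\mathsf{DL}(G)$ is the maximum such $k$. -}

module Defs where

open import Data.Nat using (ℕ; zero; suc; _<_; _^_)
import Data.Nat
open import Data.Bool using (Bool)
open import Data.Fin using (Fin; toℕ)
open import Data.Vec using (Vec; lookup)
open import Data.Product using (Σ; _×_)
open import Relation.Binary.PropositionalEquality using (_≡_; _≢_)
open import Relation.Nullary using (¬_)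
open import Function.Bundles using (_⤖_; Bijection)

Vertex : ℕ → Set
Vertex n = Vec Bool n

Adj : ∀ {n} → Vertex n → Vertex n → Set
Adj {n} u v = Σ (Fin n) λ i → (lookup u i ≢ lookup v i) × (∀ j → j ≢ i → lookup u j ≡ lookup v j)

data Walk {n : ℕ} : Vertex n → Vertex n → ℕ → Set where
  [] : ∀ {u} → Walk u u zero
  _∷_ : ∀ {u v w m} → Adj u v → Walk v w m → Walk u w (suc m)

DistAtLeast : ∀ {n} → ℕ → Vertex n → Vertex n → Set
DistAtLeast {n} k u v = ∀ m → m < k → ¬ Walk u v m

-- A k-dispersed labelling of Q_n: a bijection φ : {1..2^n} → V(Q_n)
-- (indices shifted to Fin (2^n) = {0..2^n-1}) with consecutive labels at distance ≥ k.
IsDispersed : ∀ n → ℕ → (Fin (2 ^ n) ⤖ Vertex n) → Set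
IsDispersed n k φ = ∀ (i j : Fin (2 ^ n)) → toℕ j ≡ suc (toℕ i) →
  DistAtLeast k (Bijection.to φ i) (Bijection.to φ j)

HasDispersedLabelling : ℕ → ℕ → Set
HasDispersedLabelling n k = Σ (Fin (2 ^ n) ⤖ Vertex n) λ φ → IsDispersed n k φ

DLIs : ℕ → ℕ → Set
DLIs n d = HasDispersedLabelling n d × (∀ k → HasDispersedLabelling n k → k Data.Nat.≤ d)

-- Distances in Q_n are Hamming distances. For the lower bound, list Q_{m+1} as
-- 0g₀, 1ḡ₀, 0g₁, 1ḡ₁, … where g₀, g₁, … is a Gray code of Q_m and ḡ is the
-- antipode of g: the step 0gₕ → 1ḡₕ has length m + 1, and 1ḡₕ → 0gₕ₊₁ has length
-- m because gₕ₊₁ differs from gₕ in a single coordinate. For the upper bound, an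
-- n-dispersed labelling would make every label antipodal to the previous one, so
-- the first and the third label would coincide.
module Submission where

open import Defs
open import Data.Nat using (ℕ; _≤_; _∸_; zero; suc; _+_; _*_; _<_; _^_; z≤n; s≤s; s≤s⁻¹; ⌊_/2⌋)
open import Data.Nat.Properties
open import Data.Bool using (Bool; true; false; not; _xor_)
open import Data.Bool.Properties using (not-involutive; not-¬; xor-assoc; xor-same; xor-identityʳ)
open import Data.Fin using (Fin; toℕ; fromℕ<) renaming (zero to fzero; suc to fsuc)
open import Data.Fin.Properties using (toℕ-injective; toℕ-fromℕ<; toℕ<n) renaming (suc-injective to fsuc-injective)
open import Data.Vec using (Vec; []; _∷_; lookup; map; updateAt)
open import Data.Vec.Properties using (tabulate∘lookup; tabulate-cong)
open import Data.Product using (Σ; _×_; _,_)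
open import Data.Empty using (⊥-elim)
open import Function using (_∘_; Injective)
open import Function.Bundles using (_⤖_; Bijection; mk↔ₛ′)
open import Function.Properties.Inverse using (↔⇒⤖)
open import Relation.Nullary using (contradiction)
open import Relation.Binary.PropositionalEquality
open import Algebra.Properties.CommutativeSemigroup +-commutativeSemigroup using (interchange)

bit : Bool → ℕ
bit false = 0
bit true  = 1

bit≤1 : ∀ b → bit b ≤ 1
bit≤1 false = z≤n
bit≤1 true  = s≤s z≤n

parity : ℕ → Bool
parity zero          = false
parity (suc zero)    = true
parity (suc (suc n)) = parity n

parity-suc : ∀ n → parity (suc n) ≡ not (parity n)
parity-suc zero          = refl
parity-suc (suc zero)    = refl
parity-suc (suc (suc n)) = parity-suc n

bitCons : Bool → ℕ → ℕ
bitCons b n = bit b + 2 * n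

bitCons-suc : ∀ b n → bitCons b (suc n) ≡ suc (suc (bitCons b n))
bitCons-suc false n = *-suc 2 n
bitCons-suc true  n = cong suc (*-suc 2 n)

parity-bitCons : ∀ b n → parity (bitCons b n) ≡ b
parity-bitCons false zero    = refl
parity-bitCons true  zero    = refl
parity-bitCons b     (suc n) rewrite bitCons-suc b n = parity-bitCons b n

⌊bitCons/2⌋ : ∀ b n → ⌊ bitCons b n /2⌋ ≡ n
⌊bitCons/2⌋ false zero    = refl
⌊bitCons/2⌋ true  zero    = refl
⌊bitCons/2⌋ b     (suc n) rewrite bitCons-suc b n = cong suc (⌊bitCons/2⌋ b n)

bitCons-parity-⌊/2⌋ : ∀ n → bitCons (parity n) ⌊ n /2⌋ ≡ n
bitCons-parity-⌊/2⌋ zero          = refl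
bitCons-parity-⌊/2⌋ (suc zero)    = refl
bitCons-parity-⌊/2⌋ (suc (suc n)) =
  trans (bitCons-suc (parity n) ⌊ n /2⌋) (cong (suc ∘ suc) (bitCons-parity-⌊/2⌋ n))

bitCons-injective : ∀ b m c n → bitCons b m ≡ bitCons c n → b ≡ c × m ≡ n
bitCons-injective b m c n eq =
  trans (sym (parity-bitCons b m)) (trans (cong parity eq) (parity-bitCons c n)) ,
  trans (sym (⌊bitCons/2⌋ b m)) (trans (cong ⌊_/2⌋ eq) (⌊bitCons/2⌋ c n))

⌊/2⌋-< : ∀ {n k} → n < 2 * k → ⌊ n /2⌋ < k
⌊/2⌋-< {n} {k} n<2k = *-cancelˡ-< 2 _ _ (begin-strict
  2 * ⌊ n /2⌋                  ≤⟨ m≤n+m _ (bit (parity n)) ⟩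
  bitCons (parity n) ⌊ n /2⌋   ≡⟨ bitCons-parity-⌊/2⌋ n ⟩
  n                            <⟨ n<2k ⟩
  2 * k                        ∎)
  where open ≤-Reasoning

bitCons-< : ∀ b {n k} → n < k → bitCons b n < 2 * k
bitCons-< b {n} {k} n<k = begin-strict
  bit b + 2 * n       ≤⟨ +-monoˡ-≤ (2 * n) (bit≤1 b) ⟩
  suc (2 * n)         <⟨ ≤-reflexive (sym (*-suc 2 n)) ⟩
  2 * suc n           ≤⟨ *-monoʳ-≤ 2 n<k ⟩
  2 * k               ∎
  where open ≤-Reasoning

Next : ∀ {n} → Fin n → Fin n → Set
Next i j = toℕ j ≡ suc (toℕ i)

parityᶠ : ∀ {n} → Fin n → Bool
parityᶠ i = parity (toℕ i)

-- m is a parameter rather than implicit: it cannot be recovered from an index 2 ^ m.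
module _ (m : ℕ) where

  join : Bool → Fin (2 ^ m) → Fin (2 ^ suc m)
  join b i = fromℕ< (bitCons-< b (toℕ<n i))

  halfᶠ : Fin (2 ^ suc m) → Fin (2 ^ m)
  halfᶠ j = fromℕ< (⌊/2⌋-< (toℕ<n j))

  toℕ-join : ∀ b i → toℕ (join b i) ≡ bitCons b (toℕ i)
  toℕ-join b i = toℕ-fromℕ< _

  toℕ-halfᶠ : ∀ j → toℕ (halfᶠ j) ≡ ⌊ toℕ j /2⌋
  toℕ-halfᶠ j = toℕ-fromℕ< _

  toℕ≡bitCons : ∀ j → toℕ j ≡ bitCons (parityᶠ j) (toℕ (halfᶠ j))
  toℕ≡bitCons j = sym (trans (cong (bitCons (parityᶠ j)) (toℕ-halfᶠ j)) (bitCons-parity-⌊/2⌋ (toℕ j)))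

  parityᶠ-join : ∀ b i → parityᶠ (join b i) ≡ b
  parityᶠ-join b i = trans (cong parity (toℕ-join b i)) (parity-bitCons b (toℕ i))

  halfᶠ-join : ∀ b i → halfᶠ (join b i) ≡ i
  halfᶠ-join b i = toℕ-injective
    (trans (toℕ-halfᶠ (join b i)) (trans (cong ⌊_/2⌋ (toℕ-join b i)) (⌊bitCons/2⌋ b (toℕ i))))

  join-split : ∀ j → join (parityᶠ j) (halfᶠ j) ≡ j
  join-split j = toℕ-injective (trans (toℕ-join (parityᶠ j) (halfᶠ j)) (sym (toℕ≡bitCons j)))

  data NextSplit : Bool → Fin (2 ^ m) → Bool → Fin (2 ^ m) → Set where
    within : ∀ i → NextSplit false i true i
    across : ∀ {i i′} → Next i i′ → NextSplit true i false i′

  nextSplit-bitCons : ∀ b i c k → bitCons c (toℕ k) ≡ suc (bitCons b (toℕ i)) → NextSplit b i c k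
  nextSplit-bitCons false i c k eq with refl , k≡i ← bitCons-injective c (toℕ k) true (toℕ i) eq
    with refl ← toℕ-injective k≡i = within i
  nextSplit-bitCons true i c k eq
    with refl , k≡1+i ← bitCons-injective c (toℕ k) false (suc (toℕ i))
                           (trans eq (sym (bitCons-suc false (toℕ i))))
    = across k≡1+i

  nextSplit : ∀ {j j′} → Next j j′ → NextSplit (parityᶠ j) (halfᶠ j) (parityᶠ j′) (halfᶠ j′)
  nextSplit {j} {j′} next =
    nextSplit-bitCons _ _ _ _ (trans (sym (toℕ≡bitCons j′)) (trans next (cong suc (toℕ≡bitCons j))))

hamming : ∀ {n} → Vec Bool n → Vec Bool n → ℕ
hamming []      []      = 0
hamming (a ∷ u) (b ∷ v) = bit (a xor b) + hamming u v

hamming-self : ∀ {n} (u : Vec Bool n) → hamming u u ≡ 0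
hamming-self []      = refl
hamming-self (a ∷ u) rewrite xor-same a = hamming-self u

hamming≡0⇒≡ : ∀ {n} (u v : Vec Bool n) → hamming u v ≡ 0 → u ≡ v
hamming≡0⇒≡ []          []          _ = refl
hamming≡0⇒≡ (false ∷ u) (false ∷ v) h = cong (false ∷_) (hamming≡0⇒≡ u v h)
hamming≡0⇒≡ (true ∷ u)  (true ∷ v)  h = cong (true ∷_) (hamming≡0⇒≡ u v h)
hamming≡0⇒≡ (false ∷ u) (true ∷ v)  ()
hamming≡0⇒≡ (true ∷ u)  (false ∷ v) ()

bit-xor-triangle : ∀ a b c → bit (a xor c) ≤ bit (a xor b) + bit (b xor c)
bit-xor-triangle false false c = ≤-refl
bit-xor-triangle false true  c = ≤-trans (bit≤1 c) (m≤m+n 1 _)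
bit-xor-triangle true  false c = ≤-trans (bit≤1 (not c)) (m≤m+n 1 _)
bit-xor-triangle true  true  c = ≤-refl

hamming-triangle : ∀ {n} (u v w : Vec Bool n) → hamming u w ≤ hamming u v + hamming v w
hamming-triangle []      []      []      = z≤n
hamming-triangle (a ∷ u) (b ∷ v) (c ∷ w) = begin
  bit (a xor c) + hamming u w
    ≤⟨ +-mono-≤ (bit-xor-triangle a b c) (hamming-triangle u v w) ⟩
  (bit (a xor b) + bit (b xor c)) + (hamming u v + hamming v w)
    ≡⟨ interchange (bit (a xor b)) (bit (b xor c)) (hamming u v) (hamming v w) ⟩
  (bit (a xor b) + hamming u v) + (bit (b xor c) + hamming v w)
    ∎
  where open ≤-Reasoning

hamming-antipode : ∀ {n} (u : Vec Bool n) → hamming u (map not u) ≡ n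
hamming-antipode []          = refl
hamming-antipode (false ∷ u) = cong suc (hamming-antipode u)
hamming-antipode (true ∷ u)  = cong suc (hamming-antipode u)

hamming-complement : ∀ {n} (u v : Vec Bool n) → hamming (map not u) v + hamming u v ≡ n
hamming-complement []          []          = refl
hamming-complement (false ∷ u) (false ∷ v) = cong suc (hamming-complement u v)
hamming-complement (true ∷ u)  (true ∷ v)  = cong suc (hamming-complement u v)
hamming-complement (false ∷ u) (true ∷ v)  = trans (+-suc _ _) (cong suc (hamming-complement u v))
hamming-complement (true ∷ u)  (false ∷ v) = trans (+-suc _ _) (cong suc (hamming-complement u v))

hamming-updateAt : ∀ {n} (v : Vec Bool n) k → hamming v (updateAt v k not) ≡ 1
hamming-updateAt (false ∷ v) fzero    = cong suc (hamming-self v)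
hamming-updateAt (true ∷ v)  fzero    = cong suc (hamming-self v)
hamming-updateAt (a ∷ v)     (fsuc k) rewrite xor-same a = hamming-updateAt v k

hamming-antipode-updateAt : ∀ {n} (v : Vec Bool n) k → suc (hamming (map not v) (updateAt v k not)) ≡ n
hamming-antipode-updateAt v k = begin
  suc h                              ≡⟨ +-comm 1 h ⟩
  h + 1                              ≡⟨ cong (h +_) (hamming-updateAt v k) ⟨
  h + hamming v (updateAt v k not)   ≡⟨ hamming-complement v (updateAt v k not) ⟩
  _                                  ∎
  where
  h = hamming (map not v) (updateAt v k not)
  open ≡-Reasoning

map-not-involutive : ∀ {n} (v : Vec Bool n) → map not (map not v) ≡ v
map-not-involutive []      = refl
map-not-involutive (a ∷ v) = cong₂ _∷_ (not-involutive a) (map-not-involutive v)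

n≤hamming⇒antipode : ∀ {n} {u v : Vec Bool n} → n ≤ hamming u v → v ≡ map not u
n≤hamming⇒antipode {n} {u} {v} n≤h = sym (hamming≡0⇒≡ (map not u) v (n≤0⇒n≡0 h′≤0))
  where
  h′≤0 : hamming (map not u) v ≤ 0
  h′≤0 = +-cancelʳ-≤ (hamming u v) _ 0 (≤-trans (≤-reflexive (hamming-complement u v)) n≤h)

lookup-ext : ∀ {A : Set} {n} {u v : Vec A n} → (∀ i → lookup u i ≡ lookup v i) → u ≡ v
lookup-ext {u = u} {v} eq = trans (sym (tabulate∘lookup u)) (trans (tabulate-cong eq) (tabulate∘lookup v))

≢⇒xor≡true : ∀ {a b} → a ≢ b → a xor b ≡ true
≢⇒xor≡true {false} {false} a≢b = ⊥-elim (a≢b refl)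
≢⇒xor≡true {false} {true}  _   = refl
≢⇒xor≡true {true}  {false} _   = refl
≢⇒xor≡true {true}  {true}  a≢b = ⊥-elim (a≢b refl)

adj-hamming : ∀ {n} (u v : Vertex n) → Adj u v → hamming u v ≡ 1
adj-hamming (a ∷ u) (b ∷ v) (fzero , a≢b , same)
  rewrite lookup-ext {u = u} {v} (λ i → same (fsuc i) λ ()) | ≢⇒xor≡true a≢b =
    cong suc (hamming-self v)
adj-hamming (a ∷ u) (b ∷ v) (fsuc i , uᵢ≢vᵢ , same)
  rewrite same fzero (λ ()) | xor-same b =
    adj-hamming u v (i , uᵢ≢vᵢ , λ j j≢i → same (fsuc j) (j≢i ∘ fsuc-injective))

hamming≤length : ∀ {n} {u v : Vertex n} {l} → Walk u v l → hamming u v ≤ l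
hamming≤length {u = u} []                         = ≤-reflexive (hamming-self u)
hamming≤length {u = u} {v} (_∷_ {v = w} u~w walk) =
  ≤-trans (hamming-triangle u w v) (+-mono-≤ (≤-reflexive (adj-hamming u w u~w)) (hamming≤length walk))

adj-∷ : ∀ {n} c {u v : Vertex n} → Adj u v → Adj (c ∷ u) (c ∷ v)
adj-∷ c (i , uᵢ≢vᵢ , same) =
  fsuc i , uᵢ≢vᵢ , λ { fzero _ → refl ; (fsuc j) j≢i → same j (j≢i ∘ cong fsuc) }

walk-∷ : ∀ {n} c {u v : Vertex n} {l} → Walk u v l → Walk (c ∷ u) (c ∷ v) l
walk-∷ c []           = []
walk-∷ c (u~w ∷ walk) = adj-∷ c u~w ∷ walk-∷ c walk

adj-not : ∀ {n} a (u : Vertex n) → Adj (a ∷ u) (not a ∷ u)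
adj-not a u = fzero , not-¬ refl , λ { fzero 0≢0 → ⊥-elim (0≢0 refl) ; (fsuc j) _ → refl }

hamming-walk : ∀ {n} (u v : Vertex n) → Walk u v (hamming u v)
hamming-walk []          []          = []
hamming-walk (false ∷ u) (false ∷ v) = walk-∷ false (hamming-walk u v)
hamming-walk (true ∷ u)  (true ∷ v)  = walk-∷ true (hamming-walk u v)
hamming-walk (false ∷ u) (true ∷ v)  = adj-not false u ∷ walk-∷ true (hamming-walk u v)
hamming-walk (true ∷ u)  (false ∷ v) = adj-not true u ∷ walk-∷ false (hamming-walk u v)

≤hamming⇒distAtLeast : ∀ {n k} {u v : Vertex n} → k ≤ hamming u v → DistAtLeast k u v
≤hamming⇒distAtLeast k≤h l l<k walk = <⇒≱ l<k (≤-trans k≤h (hamming≤length walk))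

distAtLeast⇒≤hamming : ∀ {n k} {u v : Vertex n} → DistAtLeast k u v → k ≤ hamming u v
distAtLeast⇒≤hamming {u = u} {v} far = ≮⇒≥ λ h<k → far _ h<k (hamming-walk u v)

xor-cancelʳ : ∀ a b → (a xor b) xor b ≡ a
xor-cancelʳ a b = trans (xor-assoc a b b) (trans (cong (a xor_) (xor-same b)) (xor-identityʳ a))

-- The binary reflected Gray code j ↦ j xor ⌊j/2⌋, least significant digit first.
gray : ∀ m → Fin (2 ^ m) → Vertex m
gray zero    _ = []
gray (suc m) j = (parityᶠ j xor parityᶠ (halfᶠ m j)) ∷ gray m (halfᶠ m j)

gray-join : ∀ m b i → gray (suc m) (join m b i) ≡ (b xor parityᶠ i) ∷ gray m i
gray-join m b i = cong₂ (λ b i → (b xor parityᶠ i) ∷ gray m i) (parityᶠ-join m b i) (halfᶠ-join m b i)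

ungray : ∀ m → Vertex m → Fin (2 ^ m)
ungray zero    []      = fzero
ungray (suc m) (c ∷ v) = join m (c xor parityᶠ (ungray m v)) (ungray m v)

gray-ungray : ∀ m v → gray m (ungray m v) ≡ v
gray-ungray zero    []      = refl
gray-ungray (suc m) (c ∷ v) =
  trans (gray-join m (c xor parityᶠ i) i) (cong₂ _∷_ (xor-cancelʳ c (parityᶠ i)) (gray-ungray m v))
  where i = ungray m v

ungray-gray : ∀ m j → ungray m (gray m j) ≡ j
ungray-gray zero    fzero = refl
ungray-gray (suc m) j = begin
  join m ((b xor parityᶠ i) xor parityᶠ (ungray m (gray m i))) (ungray m (gray m i))
    ≡⟨ cong (λ k → join m ((b xor parityᶠ i) xor parityᶠ k) k) (ungray-gray m i) ⟩
  join m ((b xor parityᶠ i) xor parityᶠ i) i   ≡⟨ cong (λ a → join m a i) (xor-cancelʳ b (parityᶠ i)) ⟩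
  join m b i                                   ≡⟨ join-split m j ⟩
  j                                            ∎
  where
  b = parityᶠ j
  i = halfᶠ m j
  open ≡-Reasoning

GrayAdjacent : ℕ → Set
GrayAdjacent m = ∀ {j j′} → Next j j′ → Σ (Fin m) λ k → gray m j′ ≡ updateAt (gray m j) k not

gray-adjacent-step : ∀ m → GrayAdjacent m → ∀ {b i c k} → NextSplit m b i c k →
  Σ (Fin (suc m)) λ k′ → (c xor parityᶠ k) ∷ gray m k ≡ updateAt ((b xor parityᶠ i) ∷ gray m i) k′ not
gray-adjacent-step m _   (within i) = fzero , refl
gray-adjacent-step m adj (across {i} i→i′) =
  let k , eq = adj i→i′ in
  fsuc k , cong₂ _∷_ (trans (cong parity i→i′) (parity-suc (toℕ i))) eq

gray-adjacent : ∀ m → GrayAdjacent m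
gray-adjacent zero    {fzero} {fzero} ()
gray-adjacent (suc m) next = gray-adjacent-step m (gray-adjacent m) (nextSplit m next)

complementIf : ∀ {n} → Bool → Vec Bool n → Vec Bool n
complementIf false v = v
complementIf true  v = map not v

complementIf-involutive : ∀ {n} b (v : Vec Bool n) → complementIf b (complementIf b v) ≡ v
complementIf-involutive false v = refl
complementIf-involutive true  v = map-not-involutive v

label : ∀ m → Fin (2 ^ suc m) → Vertex (suc m)
label m j = parityᶠ j ∷ complementIf (parityᶠ j) (gray m (halfᶠ m j))

label-join : ∀ m b i → label m (join m b i) ≡ b ∷ complementIf b (gray m i)
label-join m b i =
  cong₂ (λ b i → b ∷ complementIf b (gray m i)) (parityᶠ-join m b i) (halfᶠ-join m b i)

unlabel : ∀ m → Vertex (suc m) → Fin (2 ^ suc m)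
unlabel m (b ∷ v) = join m b (ungray m (complementIf b v))

label-unlabel : ∀ m v → label m (unlabel m v) ≡ v
label-unlabel m (b ∷ v) = begin
  label m (join m b i)                      ≡⟨ label-join m b i ⟩
  b ∷ complementIf b (gray m (ungray m v′)) ≡⟨ cong (λ w → b ∷ complementIf b w) (gray-ungray m v′) ⟩
  b ∷ complementIf b v′                     ≡⟨ cong (b ∷_) (complementIf-involutive b v) ⟩
  b ∷ v                                     ∎
  where
  v′ = complementIf b v
  i  = ungray m v′
  open ≡-Reasoning

unlabel-label : ∀ m j → unlabel m (label m j) ≡ j
unlabel-label m j = begin
  join m b (ungray m (complementIf b (complementIf b g)))
    ≡⟨ cong (join m b ∘ ungray m) (complementIf-involutive b g) ⟩
  join m b (ungray m g)  ≡⟨ cong (join m b) (ungray-gray m (halfᶠ m j)) ⟩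
  join m b (halfᶠ m j)   ≡⟨ join-split m j ⟩
  j                      ∎
  where
  b = parityᶠ j
  g = gray m (halfᶠ m j)
  open ≡-Reasoning

labelling : ∀ m → Fin (2 ^ suc m) ⤖ Vertex (suc m)
labelling m = ↔⇒⤖ (mk↔ₛ′ (label m) (unlabel m) (label-unlabel m) (unlabel-label m))

label-step : ∀ m {b i c k} → NextSplit m b i c k →
  m ≤ hamming (b ∷ complementIf b (gray m i)) (c ∷ complementIf c (gray m k))
label-step m (within i)        = m≤n⇒m≤1+n (≤-reflexive (sym (hamming-antipode (gray m i))))
label-step m (across {i} i→i′) =
  let k , eq = gray-adjacent m i→i′ in
  ≤-reflexive (sym (trans (cong (λ w → suc (hamming (map not (gray m i)) w)) eq)
                          (hamming-antipode-updateAt (gray m i) k)))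

labelling-dispersed : ∀ m → IsDispersed (suc m) m (labelling m)
labelling-dispersed m i j next = ≤hamming⇒distAtLeast (label-step m (nextSplit m next))

antipodal-sequence-length≤2 : ∀ {n N} (f : Fin N → Vertex n) → Injective _≡_ _≡_ f →
  (∀ i j → Next i j → n ≤ hamming (f i) (f j)) → N ≤ 2
antipodal-sequence-length≤2 {N = 0}                 _ _ _ = z≤n
antipodal-sequence-length≤2 {N = 1}                 _ _ _ = s≤s z≤n
antipodal-sequence-length≤2 {N = 2}                 _ _ _ = s≤s (s≤s z≤n)
antipodal-sequence-length≤2 {N = suc (suc (suc _))} f f-injective far =
  contradiction (f-injective f₂≡f₀) λ ()
  where
  f₂≡f₀ : f (fsuc (fsuc fzero)) ≡ f fzero
  f₂≡f₀ = begin
    f (fsuc (fsuc fzero))         ≡⟨ n≤hamming⇒antipode (far (fsuc fzero) (fsuc (fsuc fzero)) refl) ⟩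
    map not (f (fsuc fzero))      ≡⟨ cong (map not) (n≤hamming⇒antipode (far fzero (fsuc fzero) refl)) ⟩
    map not (map not (f fzero))   ≡⟨ map-not-involutive (f fzero) ⟩
    f fzero                       ∎
    where open ≡-Reasoning

dispersion<dimension : ∀ {n k} → 2 ≤ n → HasDispersedLabelling n k → k < n
dispersion<dimension {n} 2≤n (φ , dispersed) = ≰⇒> λ n≤k →
  <⇒≱ 2<2^n (antipodal-sequence-length≤2 (Bijection.to φ) (Bijection.injective φ)
    λ i j next → ≤-trans n≤k (distAtLeast⇒≤hamming (dispersed i j next)))
  where
  2<2^n : 2 < 2 ^ n
  2<2^n = ≤-trans (s≤s (s≤s (s≤s z≤n))) (^-monoʳ-≤ 2 2≤n)

theorem2p17 : ∀ (n : ℕ) → 2 ≤ n → DLIs n (n ∸ 1)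
theorem2p17 (suc (suc m)) 2≤n@(s≤s (s≤s z≤n)) =
  (labelling (suc m) , labelling-dispersed (suc m)) ,
  λ k dispersed → s≤s⁻¹ (dispersion<dimension 2≤n dispersed)
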